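{- The map $\alpha\mapsto R(\alpha)$ is a bijection from the set $\mathrm{SRW}(\mathbb Z^+)$ of words on which the SR algorithm does not terminate onto the set $\mathrm{STT}$ of all standard tower tableaux (of all shapes), and its inverse is the reading map $T\mapsto\mathrm{Read}(T)$.
   Context: A cell is a pair $(i,j)$ of integers with $i\ge 1$, $j\ge 0$. A tower diagram is a finite set $\mathcal T$ of cells such that $(i,j)\in\mathcal T$ and $0\le k\le j$ imply $(i,k)\in\mathcal T$. The cell $(i,j)$ lies on the diagonal $x+y=i+j$. Flight paths (recursive): a cell $(i,j)\in\mathcal T$ has a flight path in $\mathcal T$ if either (F1) there is no cell $(i',j')\in\mathcal T$ with $i'<i$ and $i'+j'=i+j-1$ (flight path $\{(i,j)\}$), or (F2) such cells exist and, letting $(i',j')$ be the one with largest $i'$, $(i',j')$ has a flight path and $(i',j'+1)\in\mathcal T$ (flight path $\{(i,j),(i',j'+1)\}\cup\mathrm{flightpath}((i',j'),\mathcal T)$). The flight number of such a cell is $a+b$ where $(a,b)$ is the lexicographically smallest element of its flight path. A corner cell of $\mathcal T$ is a cell $(i,j)\in\mathcal T$ with $(i,j+1)\notin\mathcal T$ having a flight path in $\mathcal T$. Sliding: for a positive integer $\alpha$, $\alpha^{\searrow}\mathcal T$ is computed by the procedure $P(\gamma,m)$ started at $\gamma=\alpha$, $m=1$: (S1) if no cell $(i,j)\in\mathcal T$ with $i\ge m$ lies on $x+y=\gamma-1$: (a) if $(\gamma,0)\notin\mathcal T$ the result is $\mathcal T\cup\{(\gamma,0)\}$; (b) if $(\gamma,0)\in\mathcal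 T$, $(\gamma,1)\notin\mathcal T$ the slide terminates (without result); (c) if $(\gamma,0),(\gamma,1)\in\mathcal T$, continue with $P(\gamma+1,\gamma+1)$. (S2) Otherwise let $i\ge m$ be smallest with $(i,\gamma-1-i)\in\mathcal T$: (a) if $(i,\gamma-i)\notin\mathcal T$ the result is $\mathcal T\cup\{(i,\gamma-i)\}$; (b) if $(i,\gamma-i)\in\mathcal T$, $(i,\gamma-i+1)\notin\mathcal T$ the slide terminates; (c) if both are in $\mathcal T$, continue with $P(\gamma+1,i+1)$. A tower tableau of shape $\mathcal T$ ($|\mathcal T|=n$) is a bijection $f:\mathcal T\to\{1,\dots,n\}$; it is standard if for every $a$ the set $\mathcal T_{\le a}=f^{ -1}(\{1,\dots,a\})$ is a tower diagram and $f^{ -1}(a)$ is a corner cell of $\mathcal T_{\le a}$. The reading word of a standard tower tableau $f$ is $\mathrm{Read}(f)=\alpha_1\cdots\alpha_n$, where $\alpha_k$ is the flight number of $f^{ -1}(k)$ in $\mathcal T_{\le k}$. SR algorithm: for a word $\alpha=\alpha_1\cdots\alpha_n$ of positive integers, set $\mathcal T^{(0)}=\varnothing$, $\mathcal T^{(k)}=\alpha_k^{\searrow}\mathcal T^{(k-1)}$; if some slide terminates, the algorithm terminates. Otherwise $\mathcal T^{(k)}=\mathcal T^{(k-1)}\cup\{d_k\}$ and the recording tableau $R(\alpha)$ is the tower tableau of shape $\mathcal T^{(n)}$ labelling $d_k$ by $k$. -}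

module Defs where

open import Data.Nat using (ℕ; zero; suc; _+_; _∸_; _≤_; _<_)
open import Data.Product using (_×_; _,_; Σ; ∃; ∃-syntax)
open import Data.List using (List; []; _∷_; _++_; [_])
open import Data.List.Membership.Propositional using (_∈_; _∉_)
open import Data.List.Relation.Unary.Unique.Propositional using (Unique)
open import Relation.Binary.PropositionalEquality using (_≡_; _≢_)
open import Relation.Nullary using (¬_)
open import Data.Sum using (_⊎_)

-- A cell (i , j); the condition i ≥ 1 is imposed in IsTower.
Cell : Set
Cell = ℕ × ℕ

CellSet : Set
CellSet = List Cell

IsTower : CellSet → Set
IsTower T = ∀ {i j} → (i , j) ∈ T → (1 ≤ i) × (∀ k → k ≤ j → (i , k) ∈ T)

data FlightPath (T : CellSet) : Cell → List Cell → Set where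
  F1 : ∀ {i j} →
       (∀ {i' j'} → (i' , j') ∈ T → i' < i → i' + j' ≢ (i + j) ∸ 1) →
       FlightPath T (i , j) [ (i , j) ]
  F2 : ∀ {i j i' j' P} →
       (i' , j') ∈ T → i' < i → i' + j' ≡ (i + j) ∸ 1 →
       (∀ {i'' j''} → (i'' , j'') ∈ T → i'' < i → i'' + j'' ≡ (i + j) ∸ 1 → i'' ≤ i') →
       FlightPath T (i' , j') P →
       (i' , suc j') ∈ T →
       FlightPath T (i , j) ((i , j) ∷ (i' , suc j') ∷ P)

_≤lex_ : Cell → Cell → Set
(a , b) ≤lex (a' , b') = (a < a') ⊎ ((a ≡ a') × (b ≤ b'))

FlightNumber : CellSet → Cell → ℕ → Set
FlightNumber T c n =
  Σ (List Cell) λ P → FlightPath T c P ×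
    Σ ℕ λ a → Σ ℕ λ b → ((a , b) ∈ P) × (∀ {x} → x ∈ P → (a , b) ≤lex x) × (n ≡ a + b)

Corner : CellSet → Cell → Set
Corner T (i , j) = ((i , j) ∈ T) × ((i , suc j) ∉ T) × ∃[ P ] FlightPath T (i , j) P

-- Slide T γ m d : the procedure P(γ , m) applied to T yields T ∪ {d}.
-- (A slide of α into T terminates iff there is no d with Slide T α 1 d.)
-- Cells on x+y = γ-1 are cells (i , j) with i + j ≡ γ ∸ 1 (γ ≥ 1 throughout).
data Slide (T : CellSet) : ℕ → ℕ → Cell → Set where
  S1a : ∀ {γ m} →
        (∀ {i j} → (i , j) ∈ T → m ≤ i → i + j ≢ γ ∸ 1) →
        (γ , 0) ∉ T →
        Slide T γ m (γ , 0)
  S1c : ∀ {γ m d} →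
        (∀ {i j} → (i , j) ∈ T → m ≤ i → i + j ≢ γ ∸ 1) →
        (γ , 0) ∈ T → (γ , 1) ∈ T →
        Slide T (suc γ) (suc γ) d →
        Slide T γ m d
  S2a : ∀ {γ m i j} →
        (i , j) ∈ T → m ≤ i → i + j ≡ γ ∸ 1 →
        (∀ {i' j'} → (i' , j') ∈ T → m ≤ i' → i' + j' ≡ γ ∸ 1 → i ≤ i') →
        (i , suc j) ∉ T →
        Slide T γ m (i , suc j)
  S2c : ∀ {γ m i j d} →
        (i , j) ∈ T → m ≤ i → i + j ≡ γ ∸ 1 →
        (∀ {i' j'} → (i' , j') ∈ T → m ≤ i' → i' + j' ≡ γ ∸ 1 → i ≤ i') →
        (i , suc j) ∈ T → (i , suc (suc j)) ∈ T →
        Slide T (suc γ) (suc i) d →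
        Slide T γ m d

-- SR α ds : the SR algorithm on the word α does not terminate, and
-- ds = d_1 ⋯ d_n lists the added cells; ds represents the recording
-- tableau R(α) (the cell d_k carries label k).
data SR : List ℕ → List Cell → Set where
  SR[] : SR [] []
  SR∷ : ∀ {α ds a d} → SR α ds → 1 ≤ a → Slide ds a 1 d → SR (α ++ [ a ]) (ds ++ [ d ])

-- A tower tableau f is represented by the list ds = f⁻¹(1) ⋯ f⁻¹(n)
-- of pairwise distinct cells; its shape is the set of cells of ds.
-- Standard: every T_{≤a} = {d_1,…,d_a} is a tower diagram and d_a is a
-- corner cell of it (this includes a = n, so the shape is a tower diagram,
-- and a = 0 is automatic).
Standard : List Cell → Set
Standard ds = Unique ds ×
  (∀ pre d suf → ds ≡ pre ++ d ∷ suf → IsTower (pre ++ [ d ]) × Corner (pre ++ [ d ]) d)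

data Read : List Cell → List ℕ → Set where
  Read[] : Read [] []
  Read∷ : ∀ {ds w d n} → Read ds w → FlightNumber (ds ++ [ d ]) d n →
          Read (ds ++ [ d ]) (w ++ [ n ])

-- Each continuation step (c) of the slide procedure P(γ , m) steps over a
-- column i containing both (i , γ − i) and the cell above it; this is exactly
-- one (F2) step of the flight path of the cell d finally added, read
-- backwards, and the slide starts on the diagonal of the lexicographically
-- least cell of that path.  Hence α↘T adds a corner cell d of T ∪ {d} with
-- flight number α, and conversely, following the flight path of a corner d
-- from its least cell reproduces the slide that adds d.  As both the slide and
-- the flight number are deterministic, induction on the length of the word,
-- resp. tableau, gives the bijection.
module Submission where

open import Defs
open import Data.Nat using (ℕ; zero; suc; _+_; _∸_; _≤_; _<_; z≤n; s≤s)
open import Data.Nat.Properties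
open import Data.Product using (_×_; _,_; ∃-syntax; proj₁; proj₂)
open import Data.Product.Relation.Binary.Lex.Strict using (×-transitive; ×-antisymmetric; ×-total₂)
open import Data.Product.Relation.Binary.Pointwise.NonDependent using (≡×≡⇒≡)
open import Data.Sum using (_⊎_; inj₁; inj₂)
open import Data.Empty using (⊥-elim)
open import Data.List using (List; []; _∷_; _++_; [_])
open import Data.List.Properties using (∷ʳ-injective; ++-assoc; ++-conicalʳ)
open import Data.List.Membership.Propositional using (_∈_; _∉_)
open import Data.List.Membership.Propositional.Properties using (∈-++⁺ˡ; ∈-++⁺ʳ; ∈-++⁻)
open import Data.List.Relation.Unary.All using ([]; _∷_)
import Data.List.Relation.Unary.All.Properties as All
open import Data.List.Relation.Unary.AllPairs using ([]; _∷_)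
open import Data.List.Relation.Unary.Any using (here; there)
open import Data.List.Relation.Unary.Unique.Propositional using (Unique)
import Data.List.Relation.Unary.Unique.Propositional.Properties as Unique
open import Data.List.Reverse using (Reverse; []; _∶_∶ʳ_; reverseView)
open import Relation.Binary.Definitions using (Reflexive; Transitive; Antisymmetric; Total)
open import Relation.Binary.PropositionalEquality
  using (_≡_; _≢_; refl; sym; trans; cong; subst; isEquivalence; resp₂)
open import Relation.Nullary using (yes; no)

++-∷-≢-[] : ∀ {A : Set} (xs : List A) {x ys} → xs ++ x ∷ ys ≢ []
++-∷-≢-[] xs eq with () ← ++-conicalʳ xs _ eq

∈-∷ʳ⁻ : ∀ {A : Set} {xs : List A} {y x} → x ∈ xs ++ [ y ] → x ∈ xs ⊎ x ≡ y
∈-∷ʳ⁻ {xs = xs} p with ∈-++⁻ xs p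
... | inj₁ q = inj₁ q
... | inj₂ (here q) = inj₂ q

∈-∷ʳ-≢ : ∀ {A : Set} {xs : List A} {y x} → x ∈ xs ++ [ y ] → x ≢ y → x ∈ xs
∈-∷ʳ-≢ p x≢y with ∈-∷ʳ⁻ p
... | inj₁ q = q
... | inj₂ x≡y = ⊥-elim (x≢y x≡y)

∈-∷ʳ-last : ∀ {A : Set} (xs : List A) {y} → y ∈ xs ++ [ y ]
∈-∷ʳ-last xs = ∈-++⁺ʳ xs (here refl)

Unique-∷ʳ⁺ : ∀ {A : Set} {xs : List A} {x} → Unique xs → x ∉ xs → Unique (xs ++ [ x ])
Unique-∷ʳ⁺ u x∉xs = Unique.++⁺ u ([] ∷ []) λ { (p , here refl) → x∉xs p }

Unique-∷ʳ⁻ : ∀ {A : Set} {xs : List A} {x} → Unique (xs ++ [ x ]) → Unique xs × x ∉ xs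
Unique-∷ʳ⁻ {xs = []} _ = [] , λ ()
Unique-∷ʳ⁻ {xs = y ∷ xs} (y∉ ∷ u) with Unique-∷ʳ⁻ u | All.++⁻ xs y∉
... | u′ , x∉xs | y∉xs , (y≢x ∷ []) =
  (y∉xs ∷ u′) , λ { (here refl) → y≢x refl ; (there p) → x∉xs p }

∷ʳ-decomposition : ∀ {A : Set} (xs : List A) x pre y suf → xs ++ [ x ] ≡ pre ++ y ∷ suf →
                   (pre ≡ xs × y ≡ x) ⊎ ∃[ suf′ ] xs ≡ pre ++ y ∷ suf′
∷ʳ-decomposition xs x pre y suf eq with reverseView suf
... | [] with refl , refl ← ∷ʳ-injective xs pre eq = inj₁ (refl , refl)
... | suf′ ∶ _ ∶ʳ z = inj₂ (suf′ , proj₁ (∷ʳ-injective xs (pre ++ y ∷ suf′) eq′))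
  where
  eq′ : xs ++ [ x ] ≡ (pre ++ y ∷ suf′) ++ [ z ]
  eq′ = trans eq (sym (++-assoc pre (y ∷ suf′) [ z ]))

≤lex-refl : Reflexive _≤lex_
≤lex-refl = inj₂ (refl , ≤-refl)

≤lex-trans : Transitive _≤lex_
≤lex-trans =
  ×-transitive {_≈₁_ = _≡_} {_<₁_ = _<_} {_<₂_ = _≤_} isEquivalence (resp₂ _<_) <-trans ≤-trans

≤lex-antisym : Antisymmetric _≡_ _≤lex_
≤lex-antisym p q =
  ≡×≡⇒≡ (×-antisymmetric {_≈₁_ = _≡_} {_<₁_ = _<_} {_≈₂_ = _≡_} {_<₂_ = _≤_}
                          sym <-irrefl <-asym ≤-antisym p q)

≤lex-total : Total _≤lex_
≤lex-total = ×-total₂ {_≈₁_ = _≡_} {_<₁_ = _<_} {_<₂_ = _≤_} sym <-cmp ≤-total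

lexLeast : ∀ x xs → ∃[ z ] z ∈ x ∷ xs × (∀ {y} → y ∈ x ∷ xs → z ≤lex y)
lexLeast x [] = x , here refl , λ { (here refl) → ≤lex-refl }
lexLeast x (y ∷ ys) with lexLeast y ys
... | z , z∈ , least with ≤lex-total x z
...   | inj₁ x≤z =
  x , here refl , λ { (here refl) → ≤lex-refl ; (there p) → ≤lex-trans x≤z (least p) }
...   | inj₂ z≤x = z , there z∈ , λ { (here refl) → z≤x ; (there p) → least p }

m≡n∸1⇒1+m≡n : ∀ {m n} → 1 ≤ n → m ≡ n ∸ 1 → suc m ≡ n
m≡n∸1⇒1+m≡n {n = suc n} _ = cong suc

diagonal⇒column< : ∀ {x y γ} → 1 ≤ γ → x + y ≡ γ ∸ 1 → x < γ
diagonal⇒column< {x} {y} {suc γ} _ e = s≤s (≤-trans (m≤m+n x y) (≤-reflexive e))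

m+n≡m+[1+n]∸1 : ∀ m n → m + n ≡ m + suc n ∸ 1
m+n≡m+[1+n]∸1 m n = sym (cong (_∸ 1) (+-suc m n))

suc-on-diagonal : ∀ {i j γ} → 1 ≤ γ → i + j ≡ γ ∸ 1 → i + suc j ≡ γ
suc-on-diagonal {i} {j} 1≤γ e = trans (+-suc i j) (m≡n∸1⇒1+m≡n 1≤γ e)

onDiagonal-≡ : ∀ {i j i′ j′ s} → i ≡ i′ → i + j ≡ s → i′ + j′ ≡ s → (i , j) ≡ (i′ , j′)
onDiagonal-≡ {i} refl e e′ = cong (i ,_) (+-cancelˡ-≡ i _ _ (trans e (sym e′)))

-- The side conditions of the slide procedure P(γ , m) on the diagonal s = γ ∸ 1
NoneOnDiagonal : CellSet → ℕ → ℕ → Set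
NoneOnDiagonal T s m = ∀ {x y} → (x , y) ∈ T → m ≤ x → x + y ≢ s

LeastOnDiagonal : CellSet → ℕ → ℕ → ℕ → Set
LeastOnDiagonal T s m i = ∀ {x y} → (x , y) ∈ T → m ≤ x → x + y ≡ s → i ≤ x

DiagonalGap : CellSet → ℕ → ℕ → ℕ → Set
DiagonalGap T s m k = ∀ {x y} → (x , y) ∈ T → m ≤ x → x < k → x + y ≢ s

none⇒gap : ∀ {T s m k} → NoneOnDiagonal T s m → DiagonalGap T s m k
none⇒gap none p m≤x _ = none p m≤x

least⇒gap : ∀ {T s m i} → LeastOnDiagonal T s m i → DiagonalGap T s m i
least⇒gap least p m≤x x<i e = <⇒≱ x<i (least p m≤x e)

DiagonalGap-trans : ∀ {T s l m k} → DiagonalGap T s l m → DiagonalGap T s m k →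
                    DiagonalGap T s l k
DiagonalGap-trans {m = m} gap gap′ {x} p l≤x x<k with x <? m
... | yes x<m = gap p l≤x x<m
... | no x≮m = gap′ p (≮⇒≥ x≮m) x<k

DiagonalGap-∷ʳ : ∀ {T s m k d} → DiagonalGap T s m k → k ≤ proj₁ d →
                 DiagonalGap (T ++ [ d ]) s m k
DiagonalGap-∷ʳ gap k≤d p m≤x x<k with ∈-∷ʳ⁻ p
... | inj₁ q = gap q m≤x x<k
... | inj₂ refl = λ _ → <⇒≱ x<k k≤d

NoneOnDiagonal-extend : ∀ {T s m m′} → DiagonalGap T s m m′ → NoneOnDiagonal T s m′ →
                        NoneOnDiagonal T s m
NoneOnDiagonal-extend {m′ = m′} gap none {x} p m≤x with x <? m′
... | yes x<m′ = gap p m≤x x<m′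
... | no x≮m′ = none p (≮⇒≥ x≮m′)

LeastOnDiagonal-extend : ∀ {T s m m′ i} → DiagonalGap T s m m′ → LeastOnDiagonal T s m′ i →
                         LeastOnDiagonal T s m i
LeastOnDiagonal-extend {m′ = m′} gap least {x} p m≤x e with x <? m′
... | yes x<m′ = ⊥-elim (gap p m≤x x<m′ e)
... | no x≮m′ = least p (≮⇒≥ x≮m′) e

LeastOnDiagonal-unique : ∀ {T s m i j i′ j′} → LeastOnDiagonal T s m i → LeastOnDiagonal T s m i′ →
                         (i , j) ∈ T → m ≤ i → i + j ≡ s → (i′ , j′) ∈ T → m ≤ i′ → i′ + j′ ≡ s →
                         (i , j) ≡ (i′ , j′)
LeastOnDiagonal-unique least least′ p m≤i e p′ m≤i′ e′ =
  onDiagonal-≡ (≤-antisym (least p′ m≤i′ e′) (least′ p m≤i e)) e e′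

Slide-deterministic : ∀ {T γ m d d′} → Slide T γ m d → Slide T γ m d′ → d ≡ d′
Slide-deterministic (S1a _ _) (S1a _ _) = refl
Slide-deterministic (S1a _ ∉T) (S1c _ ∈T _ _) = ⊥-elim (∉T ∈T)
Slide-deterministic (S1a none _) (S2a p m≤i e _ _) = ⊥-elim (none p m≤i e)
Slide-deterministic (S1a none _) (S2c p m≤i e _ _ _ _) = ⊥-elim (none p m≤i e)
Slide-deterministic (S1c _ ∈T _ _) (S1a _ ∉T) = ⊥-elim (∉T ∈T)
Slide-deterministic (S1c _ _ _ s) (S1c _ _ _ s′) = Slide-deterministic s s′
Slide-deterministic (S1c none _ _ _) (S2a p m≤i e _ _) = ⊥-elim (none p m≤i e)
Slide-deterministic (S1c none _ _ _) (S2c p m≤i e _ _ _ _) = ⊥-elim (none p m≤i e)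
Slide-deterministic (S2a p m≤i e _ _) (S1a none _) = ⊥-elim (none p m≤i e)
Slide-deterministic (S2a p m≤i e _ _) (S1c none _ _ _) = ⊥-elim (none p m≤i e)
Slide-deterministic (S2a p m≤i e least _) (S2a p′ m≤i′ e′ least′ _)
  with refl ← LeastOnDiagonal-unique least least′ p m≤i e p′ m≤i′ e′ = refl
Slide-deterministic (S2a p m≤i e least ∉T) (S2c p′ m≤i′ e′ least′ ∈T _ _)
  with refl ← LeastOnDiagonal-unique least least′ p m≤i e p′ m≤i′ e′ = ⊥-elim (∉T ∈T)
Slide-deterministic (S2c p m≤i e _ _ _ _) (S1a none _) = ⊥-elim (none p m≤i e)
Slide-deterministic (S2c p m≤i e _ _ _ _) (S1c none _ _ _) = ⊥-elim (none p m≤i e)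
Slide-deterministic (S2c p m≤i e least ∈T _ _) (S2a p′ m≤i′ e′ least′ ∉T)
  with refl ← LeastOnDiagonal-unique least least′ p m≤i e p′ m≤i′ e′ = ⊥-elim (∉T ∈T)
Slide-deterministic (S2c p m≤i e least _ _ s) (S2c p′ m≤i′ e′ least′ _ _ s′)
  with refl ← LeastOnDiagonal-unique least least′ p m≤i e p′ m≤i′ e′ = Slide-deterministic s s′

FlightPath-deterministic : ∀ {T c P P′} → FlightPath T c P → FlightPath T c P′ → P ≡ P′
FlightPath-deterministic (F1 _) (F1 _) = refl
FlightPath-deterministic (F1 none) (F2 p i′<i e _ _ _) = ⊥-elim (none p i′<i e)
FlightPath-deterministic (F2 p i′<i e _ _ _) (F1 none) = ⊥-elim (none p i′<i e)
FlightPath-deterministic (F2 p i′<i e largest fp _) (F2 p′ i″<i e′ largest′ fp′ _)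
  with refl ← onDiagonal-≡ (≤-antisym (largest′ p i′<i e) (largest p′ i″<i e′)) e e′ =
  cong (λ P → _ ∷ _ ∷ P) (FlightPath-deterministic fp fp′)

FlightNumber-deterministic : ∀ {T c n n′} → FlightNumber T c n → FlightNumber T c n′ → n ≡ n′
FlightNumber-deterministic (_ , fp , _ , _ , ab∈ , least , refl)
                           (_ , fp′ , _ , _ , ab∈′ , least′ , refl)
  with refl ← FlightPath-deterministic fp fp′
  with refl ← ≤lex-antisym (least ab∈′) (least′ ab∈) = refl

SR-functional : ∀ {w w′ ds ds′} → SR w ds → SR w′ ds′ → w ≡ w′ → ds ≡ ds′
SR-functional SR[] SR[] _ = refl
SR-functional SR[] (SR∷ {α = α} _ _ _) eq = ⊥-elim (++-∷-≢-[] α (sym eq))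
SR-functional (SR∷ {α = α} _ _ _) SR[] eq = ⊥-elim (++-∷-≢-[] α eq)
SR-functional (SR∷ {α = α} r _ s) (SR∷ {α = α′} r′ _ s′) eq
  with refl , refl ← ∷ʳ-injective α α′ eq
  with refl ← SR-functional r r′ refl
  with refl ← Slide-deterministic s s′ = refl

Read-functional : ∀ {ds ds′ w w′} → Read ds w → Read ds′ w′ → ds ≡ ds′ → w ≡ w′
Read-functional Read[] Read[] _ = refl
Read-functional Read[] (Read∷ {ds = ds} _ _) eq = ⊥-elim (++-∷-≢-[] ds (sym eq))
Read-functional (Read∷ {ds = ds} _ _) Read[] eq = ⊥-elim (++-∷-≢-[] ds eq)
Read-functional (Read∷ {ds = ds} r f) (Read∷ {ds = ds′} r′ f′) eq
  with refl , refl ← ∷ʳ-injective ds ds′ eq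
  with refl ← Read-functional r r′ refl
  with refl ← FlightNumber-deterministic f f′ = refl

FlightPath-head : ∀ {T c P} → FlightPath T c P → c ∈ P
FlightPath-head (F1 _) = here refl
FlightPath-head (F2 _ _ _ _ _ _) = here refl

FlightPath-⊆ : ∀ {T c P} → FlightPath T c P → c ∈ T → ∀ {x} → x ∈ P → x ∈ T
FlightPath-⊆ (F1 _) c∈T (here refl) = c∈T
FlightPath-⊆ (F2 _ _ _ _ _ _) c∈T (here refl) = c∈T
FlightPath-⊆ (F2 _ _ _ _ _ c↑∈T) _ (there (here refl)) = c↑∈T
FlightPath-⊆ (F2 p _ _ _ fp _) _ (there (there q)) = FlightPath-⊆ fp p q

FlightPath⇒FlightNumber : ∀ {T c P} → FlightPath T c P → ∃[ n ] FlightNumber T c n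
FlightPath⇒FlightNumber {P = []} ()
FlightPath⇒FlightNumber {P = x ∷ xs} fp with lexLeast x xs
... | (a , b) , ab∈ , least = a + b , x ∷ xs , fp , a , b , ab∈ , least , refl

-- The two cells prepended by an (F2) step lie lexicographically above (i′ , j′) ∈ P.
least-∈-F2-tail : ∀ {i j i′ j′ P z} → i′ < i → (i′ , j′) ∈ P →
                  z ∈ (i , j) ∷ (i′ , suc j′) ∷ P →
                  (∀ {x} → x ∈ (i , j) ∷ (i′ , suc j′) ∷ P → z ≤lex x) → z ∈ P
least-∈-F2-tail i′<i c∈P (here refl) least =
  ⊥-elim (<-irrefl (sym (cong proj₁ (≤lex-antisym (least (there (there c∈P))) (inj₁ i′<i)))) i′<i)
least-∈-F2-tail {j′ = j′} _ c∈P (there (here refl)) least =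
  ⊥-elim (1+n≢n (cong proj₂ (≤lex-antisym (least (there (there c∈P))) (inj₂ (refl , n≤1+n j′)))))
least-∈-F2-tail _ _ (there (there z∈P)) _ = z∈P

column≥1 : ∀ {T x y} → IsTower T → (x , y) ∈ T → 1 ≤ x
column≥1 tw p = proj₁ (tw p)

IsTower-∷ʳ : ∀ {T i j} → IsTower T → 1 ≤ i → (∀ k → k < j → (i , k) ∈ T) →
             IsTower (T ++ [ (i , j) ])
IsTower-∷ʳ {T} {i} {j} tw 1≤i below p with ∈-∷ʳ⁻ p
... | inj₁ q = proj₁ (tw q) , λ k k≤ → ∈-++⁺ˡ (proj₂ (tw q) k k≤)
... | inj₂ refl = 1≤i , column
  where
  column : ∀ k → k ≤ j → (i , k) ∈ T ++ [ (i , j) ]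
  column k k≤j with m≤n⇒m<n∨m≡n k≤j
  ... | inj₁ k<j = ∈-++⁺ˡ (below k k<j)
  ... | inj₂ refl = ∈-∷ʳ-last T

slide-fresh : ∀ {T γ m d} → Slide T γ m d → d ∉ T
slide-fresh (S1a _ ∉T) = ∉T
slide-fresh (S1c _ _ _ s) = slide-fresh s
slide-fresh (S2a _ _ _ _ ∉T) = ∉T
slide-fresh (S2c _ _ _ _ _ _ s) = slide-fresh s

slide-column : ∀ {T γ m d} → 1 ≤ m → m ≤ γ → Slide T γ m d → m ≤ proj₁ d
slide-column _ m≤γ (S1a _ _) = m≤γ
slide-column _ m≤γ (S1c _ _ _ s) = ≤-trans m≤γ (<⇒≤ (slide-column (s≤s z≤n) ≤-refl s))
slide-column _ _ (S2a _ m≤i _ _ _) = m≤i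
slide-column 1≤m m≤γ (S2c _ m≤i e _ _ _ s) =
  ≤-trans m≤i (<⇒≤ (slide-column (s≤s z≤n) (s≤s (<⇒≤ (diagonal⇒column< (≤-trans 1≤m m≤γ) e))) s))

slide-supported : ∀ {T γ m i j} → IsTower T → Slide T γ m (i , j) → ∀ k → k < j → (i , k) ∈ T
slide-supported tw (S1c _ _ _ s) = slide-supported tw s
slide-supported tw (S2a p _ _ _ _) k k<j = proj₂ (tw p) k (≤-pred k<j)
slide-supported tw (S2c _ _ _ _ _ _ s) = slide-supported tw s

slide-extends-tower : ∀ {T γ m d} → IsTower T → 1 ≤ m → m ≤ γ → Slide T γ m d →
                      IsTower (T ++ [ d ])
slide-extends-tower tw 1≤m m≤γ s =
  IsTower-∷ʳ tw (≤-trans 1≤m (slide-column 1≤m m≤γ s)) (slide-supported tw s)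

slide-top : ∀ {T γ m d} → IsTower T → Slide T γ m d → (proj₁ d , suc (proj₂ d)) ∉ T ++ [ d ]
slide-top tw s p with ∈-∷ʳ⁻ p
... | inj₁ q = slide-fresh s (proj₂ (tw q) _ (n≤1+n _))
... | inj₂ eq = 1+n≢n (cong proj₂ eq)

-- Trail T n γ m: the slide of n has reached P(γ , m), and every cell it passed
-- over has flight number n in the final diagram T.
data Trail (T : CellSet) (n : ℕ) : ℕ → ℕ → Set where
  trail-start : ∀ {m} → DiagonalGap T (n ∸ 1) 0 m → Trail T n n m
  trail-step : ∀ {γ i j} → (i , j) ∈ T → (i , suc j) ∈ T → i + j ≡ γ ∸ 1 →
               FlightNumber T (i , j) n → Trail T n γ (suc i)

trail-flight : ∀ {T n γ m i j} → Trail T n γ m → i + j ≡ γ → m ≤ i →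
               DiagonalGap T (γ ∸ 1) m i → FlightNumber T (i , j) n
trail-flight {i = i} {j} (trail-start gap₀) refl _ gap =
  [ (i , j) ] , F1 (λ p x<i → DiagonalGap-trans gap₀ gap p z≤n x<i) ,
  i , j , here refl , (λ { (here refl) → ≤lex-refl }) , refl
trail-flight {T} {i = i} {j}
             (trail-step {i = i₀} {j₀} c∈ c↑∈ e (P , fp , a , b , ab∈ , least , n≡)) refl i₀<i gap =
  _ , F2 c∈ i₀<i e largest fp c↑∈ , a , b , there (there ab∈) , least′ , n≡
  where
  largest : ∀ {x y} → (x , y) ∈ T → x < i → x + y ≡ (i + j) ∸ 1 → x ≤ i₀
  largest {x} p x<i e′ with x ≤? i₀
  ... | yes x≤i₀ = x≤i₀
  ... | no x≰i₀ = ⊥-elim (gap p (≰⇒> x≰i₀) x<i e′)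
  least′ : ∀ {z} → z ∈ (i , j) ∷ (i₀ , suc j₀) ∷ P → (a , b) ≤lex z
  least′ (here refl) = ≤lex-trans (least (FlightPath-head fp)) (inj₁ i₀<i)
  least′ (there (here refl)) = ≤lex-trans (least (FlightPath-head fp)) (inj₂ (refl , n≤1+n j₀))
  least′ (there (there q)) = least q

slide-flight : ∀ {T γ m n d} → 1 ≤ m → m ≤ γ → Slide T γ m d → Trail (T ++ [ d ]) n γ m →
               FlightNumber (T ++ [ d ]) d n
slide-flight {γ = γ} _ m≤γ (S1a none _) tr =
  trail-flight tr (+-identityʳ γ) m≤γ (DiagonalGap-∷ʳ (none⇒gap none) ≤-refl)
slide-flight 1≤m m≤γ (S2a _ m≤i e least _) tr =
  trail-flight tr (suc-on-diagonal (≤-trans 1≤m m≤γ) e) m≤i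
    (DiagonalGap-∷ʳ (least⇒gap least) ≤-refl)
slide-flight {γ = γ} _ m≤γ (S1c none c∈ c↑∈ s) tr =
  slide-flight (s≤s z≤n) ≤-refl s
    (trail-step (∈-++⁺ˡ c∈) (∈-++⁺ˡ c↑∈) (+-identityʳ γ)
      (trail-flight tr (+-identityʳ γ) m≤γ
        (DiagonalGap-∷ʳ (none⇒gap none) (<⇒≤ (slide-column (s≤s z≤n) ≤-refl s)))))
slide-flight {γ = γ} 1≤m m≤γ (S2c {i = i} {j} _ m≤i e least c↑∈ c↑↑∈ s) tr =
  slide-flight (s≤s z≤n) (s≤s (<⇒≤ i<γ)) s
    (trail-step (∈-++⁺ˡ c↑∈) (∈-++⁺ˡ c↑↑∈) c↑-diagonal
      (trail-flight tr c↑-diagonal m≤i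
        (DiagonalGap-∷ʳ (least⇒gap least) (<⇒≤ (slide-column (s≤s z≤n) (s≤s (<⇒≤ i<γ)) s)))))
  where
  i<γ : i < γ
  i<γ = diagonal⇒column< (≤-trans 1≤m m≤γ) e
  c↑-diagonal : i + suc j ≡ γ
  c↑-diagonal = suc-on-diagonal (≤-trans 1≤m m≤γ) e

slide-flightNumber : ∀ {T α d} → IsTower (T ++ [ d ]) → 1 ≤ α → Slide T α 1 d →
                     FlightNumber (T ++ [ d ]) d α
slide-flightNumber tw 1≤α s =
  slide-flight ≤-refl 1≤α s (trail-start λ p _ x<1 _ → <⇒≱ x<1 (column≥1 tw p))

slide-from-lower-column : ∀ {T γ m m′ d} → DiagonalGap T (γ ∸ 1) m m′ → m ≤ m′ →
                          Slide T γ m′ d → Slide T γ m d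
slide-from-lower-column gap _ (S1a none ∉T) = S1a (NoneOnDiagonal-extend gap none) ∉T
slide-from-lower-column gap _ (S1c none ∈T ∈T′ s) = S1c (NoneOnDiagonal-extend gap none) ∈T ∈T′ s
slide-from-lower-column gap m≤m′ (S2a p m′≤i e least ∉T) =
  S2a p (≤-trans m≤m′ m′≤i) e (LeastOnDiagonal-extend gap least) ∉T
slide-from-lower-column gap m≤m′ (S2c p m′≤i e least ∈T ∈T′ s) =
  S2c p (≤-trans m≤m′ m′≤i) e (LeastOnDiagonal-extend gap least) ∈T ∈T′ s

NoneOnDiagonal-pred : ∀ {T i} → 1 ≤ i → NoneOnDiagonal T (i ∸ 1) i
NoneOnDiagonal-pred 1≤i _ i≤x e = <⇒≱ (diagonal⇒column< 1≤i e) i≤x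

slide-onto-top : ∀ {T i} j → (i , j) ∉ T → IsTower (T ++ [ (i , j) ]) → Slide T (i + j) i (i , j)
slide-onto-top {T} {i} zero d∉T tw rewrite +-identityʳ i =
  S1a (NoneOnDiagonal-pred (column≥1 tw (∈-∷ʳ-last T))) d∉T
slide-onto-top {T} {i} (suc j) d∉T tw =
  S2a below ≤-refl (m+n≡m+[1+n]∸1 i j) (λ _ i≤x _ → i≤x) d∉T
  where
  below : (i , j) ∈ T
  below = ∈-∷ʳ-≢ (proj₂ (tw (∈-∷ʳ-last T)) j (n≤1+n j)) (λ eq → 1+n≢n (sym (cong proj₂ eq)))

module _ {T : CellSet} {di dj : ℕ} (d∉T : (di , dj) ∉ T) (tw : IsTower (T ++ [ (di , dj) ])) where

  private
    ∈-leftOf-d : ∀ {x y} → (x , y) ∈ T ++ [ (di , dj) ] → x < di → (x , y) ∈ T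
    ∈-leftOf-d p x<di = ∈-∷ʳ-≢ p (λ eq → <-irrefl (cong proj₁ eq) x<di)

  slide-back-step : ∀ {i j} → (i , j) ∈ T ++ [ (di , dj) ] → (i , suc j) ∈ T ++ [ (di , dj) ] →
                    i < di → Slide T (suc (i + j)) (suc i) (di , dj) → Slide T (i + j) i (di , dj)
  slide-back-step {i} {zero} c∈ c↑∈ i<di s rewrite +-identityʳ i =
    S1c (NoneOnDiagonal-pred (column≥1 tw c∈)) (∈-leftOf-d c∈ i<di) (∈-leftOf-d c↑∈ i<di) s
  slide-back-step {i} {suc j} c∈ c↑∈ i<di s =
    S2c (∈-leftOf-d (proj₂ (tw c∈) j (n≤1+n j)) i<di) ≤-refl (m+n≡m+[1+n]∸1 i j)
        (λ _ i≤x _ → i≤x) (∈-leftOf-d c∈ i<di) (∈-leftOf-d c↑∈ i<di) s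

  flightPath-slide : ∀ {i j P a b} → FlightPath (T ++ [ (di , dj) ]) (i , j) P →
                     (i , j) ∈ T ++ [ (di , dj) ] → i ≤ di →
                     (a , b) ∈ P → (∀ {x} → x ∈ P → (a , b) ≤lex x) →
                     Slide T (i + j) i (di , dj) → Slide T (a + b) 1 (di , dj)
  flightPath-slide (F1 none) c∈ _ (here refl) _ s =
    slide-from-lower-column (λ p _ x<i → none (∈-++⁺ˡ p) x<i) (column≥1 tw c∈) s
  flightPath-slide {i} {j} (F2 {i' = i′} {j' = j′} p i′<i e largest fp c↑∈) c∈ i≤di ab∈ least s =
    flightPath-slide fp p (<⇒≤ i′<di) (least-∈-F2-tail i′<i (FlightPath-head fp) ab∈ least)
      (λ q → least (there (there q))) (slide-back-step p c↑∈ i′<di s′)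
    where
    i′<di : i′ < di
    i′<di = <-≤-trans i′<i i≤di
    s′ : Slide T (suc (i′ + j′)) (suc i′) (di , dj)
    s′ = slide-from-lower-column
           (λ q i′<x x<i e′ → <⇒≱ i′<x (largest (∈-++⁺ˡ q) x<i (trans e′ e)))
           i′<i (subst (λ γ → Slide T γ i (di , dj)) diagonal s)
      where
      diagonal : i + j ≡ suc (i′ + j′)
      diagonal = sym (m≡n∸1⇒1+m≡n (≤-trans (s≤s z≤n) (≤-trans i′<i (m≤m+n i j))) e)

  flightNumber-slide : ∀ {n} → FlightNumber (T ++ [ (di , dj) ]) (di , dj) n →
                       Slide T n 1 (di , dj) × 1 ≤ n
  flightNumber-slide (_ , fp , a , b , ab∈ , least , refl) =
    flightPath-slide fp d∈ ≤-refl ab∈ least (slide-onto-top dj d∉T tw) ,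
    ≤-trans (column≥1 tw (FlightPath-⊆ fp d∈ ab∈)) (m≤m+n a b)
    where
    d∈ : (di , dj) ∈ T ++ [ (di , dj) ]
    d∈ = ∈-∷ʳ-last T

Standard-[] : Standard []
Standard-[] = [] , λ pre _ _ eq → ⊥-elim (++-∷-≢-[] pre (sym eq))

Standard-∷ʳ⁺ : ∀ {ds d} → Standard ds → d ∉ ds → IsTower (ds ++ [ d ]) → Corner (ds ++ [ d ]) d →
               Standard (ds ++ [ d ])
Standard-∷ʳ⁺ {ds} {d} (u , st) d∉ds tw corner = Unique-∷ʳ⁺ u d∉ds , st′
  where
  st′ : ∀ pre d′ suf → ds ++ [ d ] ≡ pre ++ d′ ∷ suf →
        IsTower (pre ++ [ d′ ]) × Corner (pre ++ [ d′ ]) d′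
  st′ pre d′ suf eq with ∷ʳ-decomposition ds d pre d′ suf eq
  ... | inj₁ (refl , refl) = tw , corner
  ... | inj₂ (suf′ , eq′) = st pre d′ suf′ eq′

Standard-∷ʳ⁻ : ∀ {ds d} → Standard (ds ++ [ d ]) →
               Standard ds × d ∉ ds × IsTower (ds ++ [ d ]) × Corner (ds ++ [ d ]) d
Standard-∷ʳ⁻ {ds} {d} (u , st) with Unique-∷ʳ⁻ {xs = ds} u
... | u′ , d∉ds = (u′ , st′) , d∉ds , st ds d [] refl
  where
  st′ : ∀ pre d′ suf → ds ≡ pre ++ d′ ∷ suf → IsTower (pre ++ [ d′ ]) × Corner (pre ++ [ d′ ]) d′
  st′ pre d′ suf eq =
    st pre d′ (suf ++ [ d ]) (trans (cong (_++ [ d ]) eq) (++-assoc pre (d′ ∷ suf) [ d ]))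

Standard⇒IsTower : ∀ {ds} → Standard ds → IsTower ds
Standard⇒IsTower {ds} st with reverseView ds
... | [] = λ ()
... | xs ∶ _ ∶ʳ _ = proj₁ (proj₂ (proj₂ (Standard-∷ʳ⁻ {xs} st)))

SR⇒Standard : ∀ {α ds} → SR α ds → Standard ds
SR⇒Standard SR[] = Standard-[]
SR⇒Standard (SR∷ {ds = ds} {d = d} r 1≤a s) =
  Standard-∷ʳ⁺ st (slide-fresh s) tw′
    (∈-∷ʳ-last ds , slide-top tw s , _ , proj₁ (proj₂ (slide-flightNumber tw′ 1≤a s)))
  where
  st : Standard ds
  st = SR⇒Standard r
  tw : IsTower ds
  tw = Standard⇒IsTower st
  tw′ : IsTower (ds ++ [ d ])
  tw′ = slide-extends-tower tw ≤-refl 1≤a s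

SR⇒Read : ∀ {α ds} → SR α ds → Read ds α
SR⇒Read SR[] = Read[]
SR⇒Read (SR∷ r 1≤a s) =
  Read∷ (SR⇒Read r)
    (slide-flightNumber (slide-extends-tower (Standard⇒IsTower (SR⇒Standard r)) ≤-refl 1≤a s) 1≤a s)

Standard⇒Read : ∀ {ds} → Standard ds → ∃[ w ] Read ds w
Standard⇒Read {ds} = read (reverseView ds)
  where
  read : ∀ {ds} → Reverse ds → Standard ds → ∃[ w ] Read ds w
  read [] _ = [] , Read[]
  read (xs ∶ r ∶ʳ _) st with Standard-∷ʳ⁻ {xs} st
  ... | st′ , _ , _ , (_ , _ , _ , fp) with read r st′ | FlightPath⇒FlightNumber fp
  ... | w , rd | n , fn = w ++ [ n ] , Read∷ rd fn

Read⇒SR : ∀ {ds w} → Standard ds → Read ds w → SR w ds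
Read⇒SR _ Read[] = SR[]
Read⇒SR st (Read∷ {ds} rd fn) with Standard-∷ʳ⁻ {ds} st
... | st′ , d∉ds , tw , _ with flightNumber-slide d∉ds tw fn
... | s , 1≤n = SR∷ (Read⇒SR st′ rd) 1≤n s

theorem3p10 : (∀ {α ds ds'} → SR α ds → SR α ds' → ds ≡ ds')
    × (∀ {α ds} → SR α ds → Standard ds)
    × (∀ {α ds} → SR α ds → Read ds α)
    × (∀ {ds} → Standard ds → ∃[ w ] Read ds w)
    × (∀ {ds w w'} → Standard ds → Read ds w → Read ds w' → w ≡ w')
    × (∀ {ds w} → Standard ds → Read ds w → SR w ds)
theorem3p10 =
  (λ r r′ → SR-functional r r′ refl) , SR⇒Standard , SR⇒Read , Standard⇒Read ,
  (λ _ r r′ → Read-functional r r′ refl) , Read⇒SR
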